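{- Let $k\ge 0$ be an integer and $n=48k+14$. Define $c_2(r)\in\mathbb{Z}_n$ for $0\le r\le n-1$ as follows (all arithmetic modulo $n$): for $0\le i\le 12k+3$, $c_2(2i)=6k+1+i(12k+4)$; for $0\le i\le 12k+2$, $c_2(2i+1)=12k+3+i(12k+4)$ (this defines $c_2(r)$ for $0\le r\le 24k+6$); and for $0\le r\le 24k+6$, $c_2(n-1-r)=n-1-c_2(r)$. Let ${\cal L}_2=[l_2(r,j)]$ be the $n\times n$ array with $l_2(r,j)\equiv c_2(r)+j \pmod n$ for $0\le r,j\le n-1$. Then ${\cal L}_2$ is a Latin square of order $n$ (on the symbols $0,1,\dots,n-1$).
   Context: A Latin square of order $n$ is an $n\times n$ array in which each row and each column contains each of the symbols $0,1,\dots,n-1$ exactly once. -}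

module Defs where

open import Data.Nat using (ℕ; zero; suc; _+_; _*_; _∸_; _≤ᵇ_; _<_; NonZero)
open import Data.Nat.DivMod using (_%_; _/_)
open import Data.Bool using (if_then_else_)
open import Data.Fin using (Fin; toℕ; fromℕ<)
open import Data.Nat.DivMod using (m%n<n)
open import Data.Product using (Σ; _×_; _,_)
open import Relation.Binary.PropositionalEquality using (_≡_)
open import Data.Nat using (≢-nonZero)
open import Data.Nat.Properties using (m+n≡0⇒n≡0)
open import Data.Empty using (⊥)

ExactlyOnce : ∀ {n} → (Fin n → Fin n) → Fin n → Set
ExactlyOnce {n} f s = Σ (Fin n) λ j → (f j ≡ s) × (∀ j' → f j' ≡ s → j' ≡ j)

IsLatinSquare : (n : ℕ) → (Fin n → Fin n → Fin n) → Set
IsLatinSquare n L =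
  (∀ (r s : Fin n) → ExactlyOnce (λ j → L r j) s) ×
  (∀ (j s : Fin n) → ExactlyOnce (λ r → L r j) s)

ord : ℕ → ℕ
ord k = 48 * k + 14

ord-nonZero : ∀ k → NonZero (ord k)
ord-nonZero k = ≢-nonZero (λ e → 14≢0 (m+n≡0⇒n≡0 (48 * k) e))
    where
    14≢0 : 14 ≡ 0 → ⊥
    14≢0 ()


c2-half : ℕ → ℕ → ℕ
c2-half k r with r % 2
... | 0 = _%_ (6 * k + 1 + (r / 2) * (12 * k + 4)) (ord k) ⦃ ord-nonZero k ⦄
... | _ = _%_ (12 * k + 3 + (r / 2) * (12 * k + 4)) (ord k) ⦃ ord-nonZero k ⦄

c2 : ℕ → ℕ → ℕ
c2 k r = if r ≤ᵇ 24 * k + 6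
         then c2-half k r
         else (ord k ∸ 1) ∸ c2-half k ((ord k ∸ 1) ∸ r)

L2 : (k : ℕ) → Fin (ord k) → Fin (ord k) → Fin (ord k)
L2 k r j = fromℕ< (m%n<n (c2 k (toℕ r) + toℕ j) (ord k) ⦃ ord-nonZero k ⦄)

-- Since 4(12k+4) = n + 2, multiplying by 4 turns the step 12k+4 of c₂ into a
-- step of 2 modulo n: it sends the first half of c₂ to the residues 24k+4+2i
-- (r = 2i), 48k+12 (r = 1) and 2j (r = 2j+3), which are pairwise distinct, so
-- c₂ is injective on 0..24k+6. These values of c₂ are odd (n is even), so the
-- reflected second half n-1-c₂(r) takes even values and is injective as well,
-- making c₂ a permutation of ℤₙ; and a cyclic array c(r) + j is Latin whenever
-- c is a permutation.
module Submission where

open import Defs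
open import Data.Bool using (if_then_else_)
open import Data.Bool.Properties using (T-≡; ¬-not)
open import Data.Fin using (Fin; toℕ; fromℕ<; punchOut)
open import Data.Fin.Properties
  using (toℕ<n; toℕ-fromℕ<; toℕ-injective; any?; punchOut-injective; injective⇒≤)
  renaming (_≟_ to _≟ᶠ_)
open import Data.Nat
open import Data.Nat.Divisibility using (divides)
open import Data.Nat.DivMod
open import Data.Nat.Properties
open import Data.Nat.Tactic.RingSolver using (solve-∀)
open import Data.Product using (_,_)
open import Data.Sum using (inj₁; inj₂)
open import Function using (_∘_)
open import Function.Bundles using (Equivalence)
open import Function.Definitions using (Injective)
open import Relation.Binary.PropositionalEquality
open import Relation.Nullary using (yes; no; contradiction)

injective⇒exactlyOnce : ∀ {n} (f : Fin n → Fin n) → Injective _≡_ _≡_ f →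
                        ∀ s → ExactlyOnce f s
injective⇒exactlyOnce {suc m} f f-inj s with any? (λ j → f j ≟ᶠ s)
... | yes (j , fj≡s) = j , fj≡s , λ j' fj'≡s → f-inj (trans fj'≡s (sym fj≡s))
... | no s∉im = contradiction (injective⇒≤ g-inj) 1+n≰n
  where
  -- a value s outside the image lets f squeeze Fin (suc m) into Fin m
  g : Fin (suc m) → Fin m
  g j = punchOut {i = s} {j = f j} (λ s≡fj → s∉im (j , sym s≡fj))
  g-inj : Injective _≡_ _≡_ g
  g-inj {x} {y} = f-inj ∘ punchOut-injective {i = s} {j = f x} {k = f y} _ _

data EvenOrOdd : ℕ → Set where
  even : ∀ i → EvenOrOdd (i * 2)
  odd  : ∀ i → EvenOrOdd (1 + i * 2)

evenOrOdd : ∀ r → EvenOrOdd r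
evenOrOdd zero = even 0
evenOrOdd (suc r) with evenOrOdd r
... | even i = odd i
... | odd i  = even (suc i)

module _ {d : ℕ} .{{_ : NonZero d}} where
  open ≡-Reasoning

  m≡r+q*d⇒m%d≡r : ∀ {m r} q → m ≡ r + q * d → r < d → m % d ≡ r
  m≡r+q*d⇒m%d≡r {r = r} q refl r<d = trans ([m+kn]%n≡m%n r q d) (m<n⇒m%n≡m r<d)

  m*[n%d]%d≡m*n%d : ∀ m n → m * (n % d) % d ≡ m * n % d
  m*[n%d]%d≡m*n%d m n = begin
    m * (n % d) % d           ≡⟨ %-distribˡ-* m (n % d) d ⟩
    m % d * (n % d % d) % d   ≡⟨ cong (λ x → m % d * x % d) (m%n%n≡m%n n d) ⟩
    m % d * (n % d) % d       ≡⟨ %-distribˡ-* m n d ⟨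
    m * n % d                 ∎

  m%d≡n%d⇒[m∸n]%d≡0 : ∀ m n → m % d ≡ n % d → (m ∸ n) % d ≡ 0
  m%d≡n%d⇒[m∸n]%d≡0 m n eq = begin
    (m ∸ n) % d
      ≡⟨ cong₂ (λ x y → (x ∸ y) % d) (m≡m%n+[m/n]*n m d) (m≡m%n+[m/n]*n n d) ⟩
    ((m % d + m / d * d) ∸ (n % d + n / d * d)) % d
      ≡⟨ cong (λ x → ((x + m / d * d) ∸ (n % d + n / d * d)) % d) eq ⟩
    ((n % d + m / d * d) ∸ (n % d + n / d * d)) % d
      ≡⟨ cong (_% d) ([m+n]∸[m+o]≡n∸o (n % d) (m / d * d) (n / d * d)) ⟩
    (m / d * d ∸ n / d * d) % d
      ≡⟨ cong (_% d) (*-distribʳ-∸ d (m / d) (n / d)) ⟨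
    (m / d ∸ n / d) * d % d
      ≡⟨ m*n%n≡0 (m / d ∸ n / d) d ⟩
    0 ∎

  +-%-cancelˡ : ∀ x {j j'} → j < d → j' < d → (x + j) % d ≡ (x + j') % d → j ≡ j'
  +-%-cancelˡ x j<d j'<d eq =
    ≤-antisym (m∸n≡0⇒m≤n (∸≡0 j<d eq)) (m∸n≡0⇒m≤n (∸≡0 j'<d (sym eq)))
    where
    ∸≡0 : ∀ {a b} → a < d → (x + a) % d ≡ (x + b) % d → a ∸ b ≡ 0
    ∸≡0 {a} {b} a<d eq = begin
      a ∸ b                    ≡⟨ m<n⇒m%n≡m (≤-<-trans (m∸n≤m a b) a<d) ⟨
      (a ∸ b) % d              ≡⟨ cong (_% d) ([m+n]∸[m+o]≡n∸o x a b) ⟨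
      ((x + a) ∸ (x + b)) % d  ≡⟨ m%d≡n%d⇒[m∸n]%d≡0 (x + a) (x + b) eq ⟩
      0                        ∎

  +-%-cancelʳ : ∀ x {j j'} → j < d → j' < d → (j + x) % d ≡ (j' + x) % d → j ≡ j'
  +-%-cancelʳ x {j} {j'} j<d j'<d eq = +-%-cancelˡ x j<d j'<d
    (trans (cong (_% d) (+-comm x j)) (trans eq (cong (_% d) (+-comm j' x))))

module _ {n : ℕ} .{{_ : NonZero n}} (c : ℕ → ℕ) where

  cyclic : Fin n → Fin n → Fin n
  cyclic r j = fromℕ< (m%n<n (c (toℕ r) + toℕ j) n)

  private
    toℕ-cyclic : ∀ r j → toℕ (cyclic r j) ≡ (c (toℕ r) + toℕ j) % n
    toℕ-cyclic r j = toℕ-fromℕ< (m%n<n (c (toℕ r) + toℕ j) n)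

  cyclic-isLatinSquare : (∀ r → c r < n) →
                         (∀ {r r'} → r < n → r' < n → c r ≡ c r' → r ≡ r') →
                         IsLatinSquare n cyclic
  cyclic-isLatinSquare c<n c-inj =
    (λ r → injective⇒exactlyOnce (cyclic r) row-inj) ,
    (λ j → injective⇒exactlyOnce (λ r → cyclic r j) column-inj)
    where
    row-inj : ∀ {r} → Injective _≡_ _≡_ (cyclic r)
    row-inj {r} {j} {j'} eq = toℕ-injective (+-%-cancelˡ (c (toℕ r)) (toℕ<n j) (toℕ<n j')
      (trans (sym (toℕ-cyclic r j)) (trans (cong toℕ eq) (toℕ-cyclic r j'))))
    column-inj : ∀ {j} → Injective _≡_ _≡_ (λ r → cyclic r j)
    column-inj {j} {r} {r'} eq = toℕ-injective (c-inj (toℕ<n r) (toℕ<n r')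
      (+-%-cancelʳ (toℕ j) (c<n (toℕ r)) (c<n (toℕ r'))
        (trans (sym (toℕ-cyclic r j)) (trans (cong toℕ eq) (toℕ-cyclic r' j)))))

private
  48k+14≡[24k+7]*2 : ∀ k → 48 * k + 14 ≡ (24 * k + 7) * 2
  48k+14≡[24k+7]*2 = solve-∀

  48k+14≡1+[24k+6]+1+[24k+6] : ∀ k → 48 * k + 14 ≡ suc (24 * k + 6 + suc (24 * k + 6))
  48k+14≡1+[24k+6]+1+[24k+6] = solve-∀

  48k+14≡[48k+12]+2 : ∀ k → 48 * k + 14 ≡ 48 * k + 12 + 2
  48k+14≡[48k+12]+2 = solve-∀

  m+1+m≡1+m*2 : ∀ m → m + suc m ≡ 1 + m * 2
  m+1+m≡1+m*2 = solve-∀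

  c2-even≡1+q*2 : ∀ k i → 6 * k + 1 + i * (12 * k + 4) ≡ 1 + (3 * k + i * (6 * k + 2)) * 2
  c2-even≡1+q*2 = solve-∀

  c2-odd≡1+q*2 : ∀ k i → 12 * k + 3 + i * (12 * k + 4) ≡ 1 + (6 * k + 1 + i * (6 * k + 2)) * 2
  c2-odd≡1+q*2 = solve-∀

  4*c2-even : ∀ k i → 4 * (6 * k + 1 + i * (12 * k + 4)) ≡ 24 * k + 4 + i * 2 + i * (48 * k + 14)
  4*c2-even = solve-∀

  4*c2-odd-0 : ∀ k → 4 * (12 * k + 3 + 0 * (12 * k + 4)) ≡ 48 * k + 12 + 0 * (48 * k + 14)
  4*c2-odd-0 = solve-∀

  4*c2-odd-suc : ∀ k j → 4 * (12 * k + 3 + (1 + j) * (12 * k + 4)) ≡ j * 2 + (2 + j) * (48 * k + 14)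
  4*c2-odd-suc = solve-∀

  [24k+4]+[24k+6]+2≡48k+12 : ∀ k → 24 * k + 4 + (24 * k + 6) + 2 ≡ 48 * k + 12
  [24k+4]+[24k+6]+2≡48k+12 = solve-∀

  24k+6≡2+[24k+4] : ∀ k → 24 * k + 6 ≡ 2 + (24 * k + 4)
  24k+6≡2+[24k+4] = solve-∀

module _ (k : ℕ) where
  open ≡-Reasoning

  private
    instance
      n-nonZero : NonZero (ord k)
      n-nonZero = ord-nonZero k

    n h : ℕ
    n = ord k
    h = 24 * k + 6

  c2-even c2-odd : ℕ → ℕ
  c2-even i = 6 * k + 1 + i * (12 * k + 4)
  c2-odd i = 12 * k + 3 + i * (12 * k + 4)

  -- Reasoning about c2-half through a variable remainder: abstracting r % 2
  -- directly would make Agda normalise the literal-heavy arithmetic in its body.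
  c2-half-by-rem : ℕ → ℕ → ℕ
  c2-half-by-rem r zero    = c2-even (r / 2) % n
  c2-half-by-rem r (suc _) = c2-odd (r / 2) % n

  c2-half≡c2-half-by-rem : ∀ r → c2-half k r ≡ c2-half-by-rem r (r % 2)
  c2-half≡c2-half-by-rem r with r % 2
  ... | zero  = refl
  ... | suc _ = refl

  c2-half-even : ∀ i → c2-half k (i * 2) ≡ c2-even i % n
  c2-half-even i = begin
    c2-half k (i * 2)                       ≡⟨ c2-half≡c2-half-by-rem (i * 2) ⟩
    c2-half-by-rem (i * 2) (i * 2 % 2)      ≡⟨ cong (c2-half-by-rem (i * 2)) (m*n%n≡0 i 2) ⟩
    c2-even (i * 2 / 2) % n                 ≡⟨ cong (λ q → c2-even q % n) (m*n/n≡m i 2) ⟩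
    c2-even i % n                           ∎

  c2-half-odd : ∀ i → c2-half k (1 + i * 2) ≡ c2-odd i % n
  c2-half-odd i = begin
    c2-half k (1 + i * 2)                   ≡⟨ c2-half≡c2-half-by-rem (1 + i * 2) ⟩
    c2-half-by-rem (1 + i * 2) ((1 + i * 2) % 2)
      ≡⟨ cong (c2-half-by-rem (1 + i * 2)) ([m+kn]%n≡m%n 1 i 2) ⟩
    c2-odd ((1 + i * 2) / 2) % n
      ≡⟨ cong (λ q → c2-odd q % n) (trans (+-distrib-/-∣ʳ 1 {d = 2} (divides i refl)) (m*n/n≡m i 2)) ⟩
    c2-odd i % n                            ∎

  c2-half<n : ∀ r → c2-half k r < n
  c2-half<n r = subst (_< n) (sym (c2-half≡c2-half-by-rem r)) (by-rem<n (r % 2))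
    where
    by-rem<n : ∀ b → c2-half-by-rem r b < n
    by-rem<n zero    = m%n<n (c2-even (r / 2)) n
    by-rem<n (suc _) = m%n<n (c2-odd (r / 2)) n

  c2-half-odd-valued : ∀ r → c2-half k r % 2 ≡ 1
  c2-half-odd-valued r = odd-valued (evenOrOdd r)
    where
    odd⇒%n-odd : ∀ x q → x ≡ 1 + q * 2 → x % n % 2 ≡ 1
    odd⇒%n-odd x q x≡ = begin
      x % n % 2          ≡⟨ m∣n⇒o%n%m≡o%m 2 n x (divides (24 * k + 7) (48k+14≡[24k+7]*2 k)) ⟩
      x % 2              ≡⟨ cong (_% 2) x≡ ⟩
      (1 + q * 2) % 2    ≡⟨ [m+kn]%n≡m%n 1 q 2 ⟩
      1                  ∎
    odd-valued : ∀ {r} → EvenOrOdd r → c2-half k r % 2 ≡ 1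
    odd-valued (even i) = trans (cong (_% 2) (c2-half-even i))
      (odd⇒%n-odd (c2-even i) (3 * k + i * (6 * k + 2)) (c2-even≡1+q*2 k i))
    odd-valued (odd i)  = trans (cong (_% 2) (c2-half-odd i))
      (odd⇒%n-odd (c2-odd i) (6 * k + 1 + i * (6 * k + 2)) (c2-odd≡1+q*2 k i))

  4·c2-half : ∀ {r} → EvenOrOdd r → ℕ
  4·c2-half (even i)      = 24 * k + 4 + i * 2
  4·c2-half (odd zero)    = 48 * k + 12
  4·c2-half (odd (suc j)) = j * 2

  private
    even-value<value-at-1 : ∀ i → i * 2 ≤ h → 24 * k + 4 + i * 2 < 48 * k + 12
    even-value<value-at-1 i i*2≤h = ≤-<-trans (+-monoʳ-≤ (24 * k + 4) i*2≤h)
      (subst (24 * k + 4 + h <_) ([24k+4]+[24k+6]+2≡48k+12 k) (m<m+n _ (s≤s z≤n)))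

    odd-value<24k+4 : ∀ j → 3 + j * 2 ≤ h → j * 2 < 24 * k + 4
    odd-value<24k+4 j le = s≤s⁻¹ (s≤s⁻¹ (subst (3 + j * 2 ≤_) (24k+6≡2+[24k+4] k) le))

    odd-value<even-value : ∀ i j → 3 + j * 2 ≤ h → j * 2 < 24 * k + 4 + i * 2
    odd-value<even-value i j le = <-≤-trans (odd-value<24k+4 j le) (m≤m+n (24 * k + 4) (i * 2))

    odd-value<value-at-1 : ∀ j → 3 + j * 2 ≤ h → j * 2 < 48 * k + 12
    odd-value<value-at-1 j le = <-trans (odd-value<even-value 0 j le) (even-value<value-at-1 0 z≤n)

    value-at-1<n : 48 * k + 12 < n
    value-at-1<n = subst (48 * k + 12 <_) (sym (48k+14≡[48k+12]+2 k)) (m<m+n _ (s≤s z≤n))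

    4*[x%n]%n≡ : ∀ {x} v q → 4 * x ≡ v + q * n → v < n → 4 * (x % n) % n ≡ v
    4*[x%n]%n≡ {x} v q eq v<n = trans (m*[n%d]%d≡m*n%d 4 x) (m≡r+q*d⇒m%d≡r q eq v<n)

  4*c2-half%n≡4·c2-half : ∀ {r} (p : EvenOrOdd r) → r ≤ h → 4 * c2-half k r % n ≡ 4·c2-half p
  4*c2-half%n≡4·c2-half (even i) le = trans (cong (λ x → 4 * x % n) (c2-half-even i))
    (4*[x%n]%n≡ _ i (4*c2-even k i) (<-trans (even-value<value-at-1 i le) value-at-1<n))
  4*c2-half%n≡4·c2-half (odd zero) le = trans (cong (λ x → 4 * x % n) (c2-half-odd 0))
    (4*[x%n]%n≡ _ 0 (4*c2-odd-0 k) value-at-1<n)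
  4*c2-half%n≡4·c2-half (odd (suc j)) le = trans (cong (λ x → 4 * x % n) (c2-half-odd (suc j)))
    (4*[x%n]%n≡ _ (2 + j) (4*c2-odd-suc k j) (<-trans (odd-value<value-at-1 j le) value-at-1<n))

  4·c2-half-injective : ∀ {r r'} (p : EvenOrOdd r) (p' : EvenOrOdd r') → r ≤ h → r' ≤ h →
                        4·c2-half p ≡ 4·c2-half p' → r ≡ r'
  4·c2-half-injective (even i) (even i') _ _ e = +-cancelˡ-≡ (24 * k + 4) _ _ e
  4·c2-half-injective (even i) (odd zero) le _ e =
    contradiction e (<⇒≢ (even-value<value-at-1 i le))
  4·c2-half-injective (even i) (odd (suc j')) _ le' e =
    contradiction (sym e) (<⇒≢ (odd-value<even-value i j' le'))
  4·c2-half-injective (odd zero) (even i') _ le' e =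
    contradiction (sym e) (<⇒≢ (even-value<value-at-1 i' le'))
  4·c2-half-injective (odd zero) (odd zero) _ _ e = refl
  4·c2-half-injective (odd zero) (odd (suc j')) _ le' e =
    contradiction (sym e) (<⇒≢ (odd-value<value-at-1 j' le'))
  4·c2-half-injective (odd (suc j)) (even i') le _ e =
    contradiction e (<⇒≢ (odd-value<even-value i' j le))
  4·c2-half-injective (odd (suc j)) (odd zero) le _ e =
    contradiction e (<⇒≢ (odd-value<value-at-1 j le))
  4·c2-half-injective (odd (suc j)) (odd (suc j')) _ _ e = cong (3 +_) e

  c2-half-injective : ∀ {r r'} → r ≤ h → r' ≤ h → c2-half k r ≡ c2-half k r' → r ≡ r'
  c2-half-injective {r} {r'} le le' eq = 4·c2-half-injective p p' le le' (begin
    4·c2-half p              ≡⟨ 4*c2-half%n≡4·c2-half p le ⟨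
    4 * c2-half k r % n      ≡⟨ cong (λ x → 4 * x % n) eq ⟩
    4 * c2-half k r' % n     ≡⟨ 4*c2-half%n≡4·c2-half p' le' ⟩
    4·c2-half p'             ∎)
    where
    p = evenOrOdd r
    p' = evenOrOdd r'

  c2-reflected : ℕ → ℕ
  c2-reflected r = (n ∸ 1) ∸ c2-half k ((n ∸ 1) ∸ r)

  c2-low : ∀ {r} → r ≤ h → c2 k r ≡ c2-half k r
  c2-low {r} r≤h = cong (λ b → if b then c2-half k r else c2-reflected r)
    (Equivalence.to T-≡ (≤⇒≤ᵇ r≤h))

  c2-high : ∀ {r} → h < r → c2 k r ≡ c2-reflected r
  c2-high {r} h<r = cong (λ b → if b then c2-half k r else c2-reflected r)
    (¬-not (λ r≤ᵇh → <⇒≱ h<r (≤ᵇ⇒≤ r h (Equivalence.from T-≡ r≤ᵇh))))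

  private
    n≡1+h+1+h : n ≡ suc (h + suc h)
    n≡1+h+1+h = 48k+14≡1+[24k+6]+1+[24k+6] k

    n∸1≡h+1+h : n ∸ 1 ≡ h + suc h
    n∸1≡h+1+h = cong (_∸ 1) n≡1+h+1+h

    n∸1<n : n ∸ 1 < n
    n∸1<n = subst₂ _<_ (sym n∸1≡h+1+h) (sym n≡1+h+1+h) ≤-refl

    <n⇒≤n∸1 : ∀ {x} → x < n → x ≤ n ∸ 1
    <n⇒≤n∸1 {x} x<n = subst (x ≤_) (sym n∸1≡h+1+h) (s≤s⁻¹ (subst (x <_) n≡1+h+1+h x<n))

    reflect-≤h : ∀ {r} → h < r → (n ∸ 1) ∸ r ≤ h
    reflect-≤h {r} h<r = subst (λ m → m ∸ r ≤ h) (sym n∸1≡h+1+h)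
      (≤-trans (∸-monoʳ-≤ (h + suc h) h<r) (≤-reflexive (m+n∸n≡m h (suc h))))

    n∸1-odd : (n ∸ 1) % 2 ≡ 1
    n∸1-odd = trans (cong (_% 2) (trans n∸1≡h+1+h (m+1+m≡1+m*2 h))) ([m+kn]%n≡m%n 1 h 2)

  c2-reflected-even-valued : ∀ r → c2-reflected r % 2 ≡ 0
  c2-reflected-even-valued r = m%d≡n%d⇒[m∸n]%d≡0 (n ∸ 1) (c2-half k ((n ∸ 1) ∸ r))
    (trans n∸1-odd (sym (c2-half-odd-valued ((n ∸ 1) ∸ r))))

  c2<n : ∀ r → c2 k r < n
  c2<n r with ≤-<-connex r h
  ... | inj₁ r≤h = subst (_< n) (sym (c2-low r≤h)) (c2-half<n r)
  ... | inj₂ h<r = subst (_< n) (sym (c2-high h<r))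
    (≤-<-trans (m∸n≤m (n ∸ 1) (c2-half k ((n ∸ 1) ∸ r))) n∸1<n)

  private
    low≢high : ∀ {r r'} → r ≤ h → h < r' → c2 k r ≢ c2 k r'
    low≢high {r} {r'} r≤h h<r' eq = 1+n≢0 (begin
      1                    ≡⟨ c2-half-odd-valued r ⟨
      c2-half k r % 2      ≡⟨ cong (_% 2) (trans (sym (c2-low r≤h)) (trans eq (c2-high h<r'))) ⟩
      c2-reflected r' % 2  ≡⟨ c2-reflected-even-valued r' ⟩
      0                    ∎)

  c2-injective : ∀ {r r'} → r < n → r' < n → c2 k r ≡ c2 k r' → r ≡ r'
  c2-injective {r} {r'} r<n r'<n eq with ≤-<-connex r h | ≤-<-connex r' h
  ... | inj₁ r≤h | inj₁ r'≤h =
    c2-half-injective r≤h r'≤h (trans (sym (c2-low r≤h)) (trans eq (c2-low r'≤h)))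
  ... | inj₁ r≤h | inj₂ h<r' = contradiction eq (low≢high r≤h h<r')
  ... | inj₂ h<r | inj₁ r'≤h = contradiction (sym eq) (low≢high r'≤h h<r)
  ... | inj₂ h<r | inj₂ h<r' =
    ∸-cancelˡ-≡ (<n⇒≤n∸1 r<n) (<n⇒≤n∸1 r'<n)
      (c2-half-injective (reflect-≤h h<r) (reflect-≤h h<r')
        (∸-cancelˡ-≡ (<n⇒≤n∸1 (c2-half<n ((n ∸ 1) ∸ r)))
                     (<n⇒≤n∸1 (c2-half<n ((n ∸ 1) ∸ r')))
          (trans (sym (c2-high h<r)) (trans eq (c2-high h<r')))))

lemma2 : (k : ℕ) → IsLatinSquare (ord k) (L2 k)
lemma2 k = cyclic-isLatinSquare ⦃ ord-nonZero k ⦄ (c2 k) (c2<n k) (c2-injective k)
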